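{- For any tree $T$ with at least one edge, the set of leaves of $T$ is the unique MEG-set of $T$ of minimum size.
   Context: Two vertices $x,y$ of a graph $G$ monitor an edge $e$ if $e$ belongs to all shortest paths between $x$ and $y$. A set $S\subseteq V(G)$ is a monitoring edge-geodetic set (MEG-set) if for every edge $e$ of $G$ there is a pair $x,y\in S$ that monitors $e$. A leaf is a vertex of degree $1$. -}

module Defs where

open import Data.Nat using (ℕ; zero; suc; _≤_; _≟_)
open import Data.Fin using (Fin)
open import Data.Fin.Subset using (Subset; _∈_; ∣_∣)
open import Data.List using (List; []; _∷_; length; filter; allFin)
open import Data.List.Relation.Unary.Unique.Propositional using (Unique)
open import Data.Vec using (tabulate)
open import Data.Product using (Σ; ∃; ∃-syntax; _×_; _,_)
open import Data.Sum using (_⊎_)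
open import Data.Empty using (⊥)
open import Relation.Nullary using (¬_; Dec; does)
open import Relation.Binary.PropositionalEquality using (_≡_)

record Graph (n : ℕ) : Set₁ where
  field
    Adj   : Fin n → Fin n → Set
    adj?  : (u v : Fin n) → Dec (Adj u v)
    sym   : ∀ {u v} → Adj u v → Adj v u
    irrefl : ∀ {u} → ¬ Adj u u

module _ {n : ℕ} (G : Graph n) where
  open Graph G

  data Walk : Fin n → Fin n → ℕ → Set where
    []  : ∀ {x} → Walk x x 0
    _∷_ : ∀ {x y z k} → Adj x y → Walk y z k → Walk x z (suc k)

  vertices : ∀ {x y k} → Walk x y k → List (Fin n)
  vertices {x} []      = x ∷ []
  vertices {x} (_ ∷ w) = x ∷ vertices w

  IsPath : ∀ {x y k} → Walk x y k → Set
  IsPath w = Unique (vertices w)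

  data UsesEdge (u v : Fin n) : ∀ {x y k} → Walk x y k → Set where
    here  : ∀ {x y z k} (a : Adj x y) (w : Walk y z k) →
            (x ≡ u × y ≡ v) ⊎ (x ≡ v × y ≡ u) → UsesEdge u v (a ∷ w)
    there : ∀ {x y z k} (a : Adj x y) (w : Walk y z k) →
            UsesEdge u v w → UsesEdge u v (a ∷ w)

  IsShortestPath : ∀ {x y k} → Walk x y k → Set
  IsShortestPath {x} {y} {k} w =
    IsPath w × (∀ {k'} (w' : Walk x y k') → IsPath w' → k ≤ k')

  Monitors : Fin n → Fin n → Fin n → Fin n → Set
  Monitors x y u v = ∀ {k} (w : Walk x y k) → IsShortestPath w → UsesEdge u v w

  IsMEG : Subset n → Set
  IsMEG S = ∀ u v → Adj u v → ∃[ x ] ∃[ y ] (x ∈ S × y ∈ S × Monitors x y u v)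

  Connected : Set
  Connected = ∀ x y → ∃[ k ] Walk x y k

  -- a cycle: a closed walk of length ≥ 3 whose vertices (apart from the
  -- repeated start/end vertex) are pairwise distinct
  HasCycle : Set
  HasCycle = ∃[ x ] ∃[ y ] ∃[ k ] Σ (Adj x y) λ a → Σ (Walk y x k) λ w →
             (2 ≤ k × Unique (vertices w))

  IsTree : Set
  IsTree = Connected × ¬ HasCycle

  HasEdge : Set
  HasEdge = ∃[ u ] ∃[ v ] Adj u v

  degree : Fin n → ℕ
  degree v = length (filter (adj? v) (allFin n))

  IsLeaf : Fin n → Set
  IsLeaf v = degree v ≡ 1

  leaves : Subset n
  leaves = tabulate (λ v → does (degree v ≟ 1))

-- Every leaf l lies in every MEG-set S: if its edge l w were monitored by
-- x, y ≠ l, then l would be an inner vertex of a shortest x–y path and so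
-- would have two neighbours. Conversely the leaves themselves form an
-- MEG-set of a forest: starting from an edge u v and walking away from v
-- as long as possible reaches a leaf X, and likewise a leaf Y beyond v;
-- an X–Y walk avoiding u v would then close a cycle through u v. Hence the
-- leaves are contained in every MEG-set, which gives both minimality and
-- uniqueness.
module Submission where

open import Defs
open import Data.Nat using (ℕ; zero; suc; _+_; _≤_; _<_; z≤n; s≤s) renaming (_≟_ to _≟ℕ_)
open import Data.Nat.Properties using (≤-refl; ≤-trans; ≤-reflexive; m≤n⇒m≤1+n; ≮⇒≥; <-irrefl; anyUpTo?)
open import Data.Nat.Induction using (<-wellFounded)
open import Induction.WellFounded using (Acc; acc)
open import Data.Fin using (Fin; _≟_)
open import Data.Fin.Properties using (any?)
open import Data.Fin.Subset using (Subset; ∣_∣; inside; outside) renaming (_∈_ to _∈ₛ_; _⊆_ to _⊆ₛ_)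
open import Data.Fin.Subset.Properties using (p⊆q⇒∣p∣≤∣q∣; drop-∷-⊆)
open import Data.List using (List; []; _∷_; length; filter; allFin; _++_)
open import Data.List.Membership.Propositional using (_∈_; _∉_)
open import Data.List.Membership.Propositional.Properties using (∈-allFin; ∈-filter⁺; ∈-filter⁻; ∈-++⁺ˡ; ∈-++⁺ʳ)
open import Data.List.Relation.Binary.Subset.Propositional using (_⊆_)
open import Data.List.Relation.Unary.Any using (here; there)
open import Data.List.Relation.Unary.All as All using ([]; _∷_)
open import Data.List.Relation.Unary.All.Properties using (¬Any⇒All¬)
open import Data.List.Relation.Unary.AllPairs using ([]; _∷_)
open import Data.List.Relation.Unary.Unique.Propositional using (Unique)
open import Data.List.Relation.Unary.Unique.Propositional.Properties using (allFin⁺; filter⁺; ++⁺)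
open import Data.Bool using (true)
open import Data.Vec using ([]; _∷_; here)
open import Data.Vec.Properties using (lookup⇒[]=; []=⇒lookup; lookup∘tabulate)
open import Data.Product using (Σ; ∃; ∃₂; _×_; _,_; proj₁; proj₂)
open import Data.Sum using (_⊎_; inj₁; inj₂)
open import Function using (_∘_)
open import Relation.Nullary using (¬_; Dec; yes; no; does; contradiction)
open import Relation.Nullary.Decidable using (dec-true; ¬?; _×-dec_)
open import Relation.Unary using (Decidable)
open import Relation.Binary.PropositionalEquality using (_≡_; _≢_; refl; sym; trans; cong; subst)

length≡1⇒≡[x] : ∀ {A : Set} {xs : List A} → length xs ≡ 1 → ∃ λ x → xs ≡ x ∷ []
length≡1⇒≡[x] {xs = x ∷ []} refl = x , refl

unique-constant⇒length≡1 : ∀ {A : Set} {x : A} {xs} → Unique xs → x ∈ xs →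
                           (∀ {z} → z ∈ xs → z ≡ x) → length xs ≡ 1
unique-constant⇒length≡1 {xs = _ ∷ []}    _             _ _     = refl
unique-constant⇒length≡1 {xs = _ ∷ _ ∷ _} (y∉ ∷ _) _ const =
  contradiction (trans (const (here refl)) (sym (const (there (here refl))))) (All.head y∉)

module _ {A : Set} {P Q : A → Set} (P? : Decidable P) (Q? : Decidable Q) (Q⇒P : ∀ {z} → Q z → P z) where

  length-filter-mono : ∀ xs → length (filter Q? xs) ≤ length (filter P? xs)
  length-filter-mono []       = z≤n
  length-filter-mono (x ∷ xs) with Q? x | P? x
  ... | yes _ | yes _  = s≤s (length-filter-mono xs)
  ... | yes q | no ¬p  = contradiction (Q⇒P q) ¬p
  ... | no _  | yes _  = m≤n⇒m≤1+n (length-filter-mono xs)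
  ... | no _  | no _   = length-filter-mono xs

  length-filter-strict-mono : ∀ {c xs} → P c → ¬ Q c → c ∈ xs →
                              length (filter Q? xs) < length (filter P? xs)
  length-filter-strict-mono {xs = x ∷ xs} pc ¬qc (here refl) with Q? x | P? x
  ... | yes qc | _     = contradiction qc ¬qc
  ... | no _   | yes _ = s≤s (length-filter-mono xs)
  ... | no _   | no ¬p = contradiction pc ¬p
  length-filter-strict-mono {xs = x ∷ xs} pc ¬qc (there c∈) with Q? x | P? x
  ... | yes _ | yes _ = s≤s (length-filter-strict-mono pc ¬qc c∈)
  ... | yes q | no ¬p = contradiction (Q⇒P q) ¬p
  ... | no _  | yes _ = m≤n⇒m≤1+n (length-filter-strict-mono pc ¬qc c∈)
  ... | no _  | no _  = length-filter-strict-mono pc ¬qc c∈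

p⊆q⇒∣q∣≤∣p∣⇒q≡p : ∀ {m} {p q : Subset m} → p ⊆ₛ q → ∣ q ∣ ≤ ∣ p ∣ → q ≡ p
p⊆q⇒∣q∣≤∣p∣⇒q≡p {p = []}          {[]}          _   _         = refl
p⊆q⇒∣q∣≤∣p∣⇒q≡p {p = outside ∷ p} {outside ∷ q} p⊆q ∣q∣≤∣p∣   =
  cong (outside ∷_) (p⊆q⇒∣q∣≤∣p∣⇒q≡p (drop-∷-⊆ p⊆q) ∣q∣≤∣p∣)
p⊆q⇒∣q∣≤∣p∣⇒q≡p {p = outside ∷ p} {inside ∷ q}  p⊆q ∣q∣≤∣p∣   =
  contradiction (≤-trans ∣q∣≤∣p∣ (p⊆q⇒∣p∣≤∣q∣ (drop-∷-⊆ p⊆q))) (<-irrefl refl)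
p⊆q⇒∣q∣≤∣p∣⇒q≡p {p = inside ∷ p}  {outside ∷ q} p⊆q _         = contradiction (p⊆q here) λ ()
p⊆q⇒∣q∣≤∣p∣⇒q≡p {p = inside ∷ p}  {inside ∷ q}  p⊆q (s≤s ∣q∣≤∣p∣) =
  cong (inside ∷_) (p⊆q⇒∣q∣≤∣p∣⇒q≡p (drop-∷-⊆ p⊆q) ∣q∣≤∣p∣)

module _ {n : ℕ} (G : Graph n) where
  open Graph G renaming (sym to adj-sym)
  open import Data.List.Membership.DecPropositional (_≟_ {n}) using (_∈?_)

  _⊆ᴱ_ : ∀ {a b c d k l} → Walk G a b k → Walk G c d l → Set
  p ⊆ᴱ w = ∀ {u v} → UsesEdge G u v p → UsesEdge G u v w

  start∈vertices : ∀ {x y k} (w : Walk G x y k) → x ∈ vertices G w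
  start∈vertices []      = here refl
  start∈vertices (_ ∷ _) = here refl

  UsesEdge⇒∈ : ∀ {u v x y k} (w : Walk G x y k) → UsesEdge G u v w →
               u ∈ vertices G w × v ∈ vertices G w
  UsesEdge⇒∈ (_ ∷ w) (here _ _ (inj₁ (refl , refl))) = here refl , there (start∈vertices w)
  UsesEdge⇒∈ (_ ∷ w) (here _ _ (inj₂ (refl , refl))) = there (start∈vertices w) , here refl
  UsesEdge⇒∈ (_ ∷ w) (there _ _ uses)                 =
    let u∈ , v∈ = UsesEdge⇒∈ w uses in there u∈ , there v∈

  _++ʷ_ : ∀ {x y z k l} → Walk G x y k → Walk G y z l → Walk G x z (k + l)
  []      ++ʷ q = q
  (a ∷ p) ++ʷ q = a ∷ (p ++ʷ q)

  UsesEdge-++⁻ : ∀ {u v x y z k l} (p : Walk G x y k) (q : Walk G y z l) →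
                 UsesEdge G u v (p ++ʷ q) → UsesEdge G u v p ⊎ UsesEdge G u v q
  UsesEdge-++⁻ []      q uses                  = inj₂ uses
  UsesEdge-++⁻ (a ∷ p) q (here _ _ e)          = inj₁ (here a p e)
  UsesEdge-++⁻ (a ∷ p) q (there _ _ uses) with UsesEdge-++⁻ p q uses
  ... | inj₁ usesₚ = inj₁ (there a p usesₚ)
  ... | inj₂ usesₑ = inj₂ usesₑ

  _▷_ : ∀ {x y z k} → Walk G x y k → Adj y z → Walk G x z (suc k)
  []      ▷ e = e ∷ []
  (a ∷ p) ▷ e = a ∷ (p ▷ e)

  vertices-▷ : ∀ {x y z k} (p : Walk G x y k) (e : Adj y z) →
               vertices G (p ▷ e) ≡ vertices G p ++ z ∷ []
  vertices-▷ []      e = refl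
  vertices-▷ (a ∷ p) e = cong (_ ∷_) (vertices-▷ p e)

  ▷-IsPath : ∀ {x y z k} (p : Walk G x y k) (e : Adj y z) →
             IsPath G p → z ∉ vertices G p → IsPath G (p ▷ e)
  ▷-IsPath p e up z∉ = subst Unique (sym (vertices-▷ p e)) (++⁺ up ([] ∷ []) λ { (z∈ , here refl) → z∉ z∈ })

  ∉-▷⁻ : ∀ {x y z w k} (p : Walk G x y k) (e : Adj y z) →
         w ∉ vertices G (p ▷ e) → w ∉ vertices G p × w ≢ z
  ∉-▷⁻ p e w∉ rewrite vertices-▷ p e = w∉ ∘ ∈-++⁺ˡ , λ { refl → w∉ (∈-++⁺ʳ (vertices G p) (here refl)) }

  reverse : ∀ {x y k} (w : Walk G x y k) → ∃ λ k′ → Σ (Walk G y x k′) (_⊆ᴱ w)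
  reverse []      = 0 , [] , λ ()
  reverse (a ∷ w) with reverse w
  ... | _ , r , r⊆w = _ , r ++ʷ (adj-sym a ∷ []) , last-edge ∘ UsesEdge-++⁻ r _
    where
    last-edge : ∀ {u v} → UsesEdge G u v r ⊎ UsesEdge G u v (adj-sym a ∷ []) → UsesEdge G u v (a ∷ w)
    last-edge (inj₁ uses)                              = there a w (r⊆w uses)
    last-edge (inj₂ (here _ _ (inj₁ (refl , refl)))) = here a w (inj₂ (refl , refl))
    last-edge (inj₂ (here _ _ (inj₂ (refl , refl)))) = here a w (inj₁ (refl , refl))

  PathWithin : ∀ {a b l} → Fin n → Fin n → ℕ → Walk G a b l → Set
  PathWithin x z k w = ∃ λ k′ → k′ ≤ k × Σ (Walk G x z k′) λ p → IsPath G p × p ⊆ᴱ w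

  suffix : ∀ {x y z k} (p : Walk G y z k) → IsPath G p → x ∈ vertices G p → PathWithin x z k p
  suffix []      up (here refl)       = 0 , z≤n , [] , up , λ ()
  suffix (a ∷ p) up (here refl)       = _ , ≤-refl , a ∷ p , up , λ uses → uses
  suffix (a ∷ p) (_ ∷ up) (there x∈) =
    let k′ , k′≤ , s , us , s⊆p = suffix p up x∈
    in k′ , m≤n⇒m≤1+n k′≤ , s , us , there a p ∘ s⊆p

  walk⇒path : ∀ {x z k} (w : Walk G x z k) → PathWithin x z k w
  walk⇒path []       = 0 , z≤n , [] , [] ∷ [] , λ ()
  walk⇒path {x} (a ∷ w) with walk⇒path w
  ... | k′ , k′≤ , p , up , p⊆w with x ∈? vertices G p
  ...   | yes x∈ = let k″ , k″≤ , s , us , s⊆p = suffix p up x∈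
                   in k″ , m≤n⇒m≤1+n (≤-trans k″≤ k′≤) , s , us , there a w ∘ p⊆w ∘ s⊆p
  ...   | no x∉  = suc k′ , s≤s k′≤ , a ∷ p , ¬Any⇒All¬ _ x∉ ∷ up , extend
    where
    extend : (a ∷ p) ⊆ᴱ (a ∷ w)
    extend (here _ _ e)     = here a w e
    extend (there _ _ uses) = there a w (p⊆w uses)

  prefix : ∀ {x y z k} (p : Walk G x y k) → IsPath G p → z ∈ vertices G p →
           ∃ λ k′ → Σ (Walk G x z k′) λ q → IsPath G q × vertices G q ⊆ vertices G p
  prefix []      _          (here refl) = 0 , [] , [] ∷ [] , λ z∈ → z∈
  prefix (a ∷ p) _          (here refl) = 0 , [] , [] ∷ [] , λ { (here refl) → here refl }
  prefix (a ∷ p) (x∉ ∷ up) (there z∈) =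
    let k′ , q , uq , q⊆p = prefix p up z∈
    in suc k′ , a ∷ q , All.tabulate (All.lookup x∉ ∘ q⊆p) ∷ uq ,
       λ { (here refl) → here refl ; (there y∈) → there (q⊆p y∈) }

  walk? : ∀ k x y → Dec (Walk G x y k)
  walk? zero x y with x ≟ y
  ... | yes refl = yes []
  ... | no x≢y   = no λ { [] → x≢y refl }
  walk? (suc k) x y with any? (λ z → adj? x z ×-dec walk? k z y)
  ... | yes (_ , a , w) = yes (a ∷ w)
  ... | no ∄            = no λ { (a ∷ w) → ∄ (_ , a , w) }

  least-walk : ∀ {x y K} → Acc _<_ K → Walk G x y K →
               ∃ λ k → Walk G x y k × (∀ {j} → Walk G x y j → k ≤ j)
  least-walk {x} {y} {K} (acc rs) w with anyUpTo? (λ j → walk? j x y) K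
  ... | yes (j , j<K , w′) = least-walk (rs j<K) w′
  ... | no ∄               = K , w , λ w′ → ≮⇒≥ λ j<K → ∄ (_ , j<K , w′)

  shortest-path : ∀ {x y K} → Walk G x y K → ∃ λ k → Σ (Walk G x y k) (IsShortestPath G)
  shortest-path {K = K} w with least-walk (<-wellFounded K) w
  ... | m , w₀ , least with walk⇒path w₀
  ... | k , k≤m , p , up , _ = k , p , up , λ w′ _ → ≤-trans k≤m (least w′)

  neighbours : Fin n → List (Fin n)
  neighbours v = filter (adj? v) (allFin n)

  leaf-neighbour : ∀ {l} → IsLeaf G l → ∃ (Adj l)
  leaf-neighbour {l} leaf with length≡1⇒≡[x] {xs = neighbours l} leaf
  ... | a , eq = a , proj₂ (∈-filter⁻ (adj? l) {xs = allFin n} (subst (a ∈_) (sym eq) (here refl)))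

  leaf-neighbours-equal : ∀ {l a b} → IsLeaf G l → Adj l a → Adj l b → a ≡ b
  leaf-neighbours-equal {l} leaf la lb with length≡1⇒≡[x] {xs = neighbours l} leaf
  ... | x , eq = trans (is-x la) (sym (is-x lb))
    where
    is-x : ∀ {c} → Adj l c → c ≡ x
    is-x {c} lc with subst (c ∈_) eq (∈-filter⁺ (adj? l) (∈-allFin c) lc)
    ... | here c≡x = c≡x

  unique-neighbour⇒leaf : ∀ {l a} → Adj l a → (∀ {c} → Adj l c → c ≡ a) → IsLeaf G l
  unique-neighbour⇒leaf {l} la unique =
    unique-constant⇒length≡1 (filter⁺ (adj? l) (allFin⁺ n))
      (∈-filter⁺ (adj? l) (∈-allFin _) la) (unique ∘ proj₂ ∘ ∈-filter⁻ (adj? l) {xs = allFin n})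

  ∈-leaves⁺ : ∀ {x} → IsLeaf G x → x ∈ₛ leaves G
  ∈-leaves⁺ {x} leaf = lookup⇒[]= x _ (trans (lookup∘tabulate _ x) (dec-true (degree G x ≟ℕ 1) leaf))

  ∈-leaves⁻ : ∀ {x} → x ∈ₛ leaves G → IsLeaf G x
  ∈-leaves⁻ {x} x∈ =
    from-does (degree G x ≟ℕ 1) (trans (sym (lookup∘tabulate _ x)) ([]=⇒lookup x∈))
    where
    from-does : (d : Dec (IsLeaf G x)) → does d ≡ true → IsLeaf G x
    from-does (yes leaf) _ = leaf

  HasTwoNeighbours : Fin n → Set
  HasTwoNeighbours l = ∃₂ λ a b → a ≢ b × Adj l a × Adj l b

  leaf⇒¬HasTwoNeighbours : ∀ {l} → IsLeaf G l → ¬ HasTwoNeighbours l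
  leaf⇒¬HasTwoNeighbours leaf (_ , _ , a≢b , la , lb) = a≢b (leaf-neighbours-equal leaf la lb)

  inner-vertex⇒HasTwoNeighbours : ∀ {l x y k} (p : Walk G x y k) → IsPath G p →
                                  l ∈ vertices G p → l ≢ x → l ≢ y → HasTwoNeighbours l
  inner-vertex⇒HasTwoNeighbours []      _ (here refl) l≢x _ = contradiction refl l≢x
  inner-vertex⇒HasTwoNeighbours (_ ∷ _) _ (here refl) l≢x _ = contradiction refl l≢x
  inner-vertex⇒HasTwoNeighbours {l} (_∷_ {y = z} a p) (x∉ ∷ up) (there l∈) _ l≢y with l ≟ z
  ... | no l≢z   = inner-vertex⇒HasTwoNeighbours p up l∈ l≢z l≢y
  ... | yes refl with p | x∉
  ...   | []    | _        = contradiction refl l≢y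
  ...   | b ∷ q | _ ∷ x∉q = _ , _ , All.lookup x∉q (start∈vertices q) , adj-sym a , b

  leaves⊆MEG : Connected G → ∀ {S} → IsMEG G S → leaves G ⊆ₛ S
  leaves⊆MEG connected {S} meg {l} l∈ with leaf-neighbour (∈-leaves⁻ l∈)
  ... | w , lw with meg l w lw
  ... | x , y , x∈S , y∈S , monitors with x ≟ l | y ≟ l
  ... | yes refl | _        = x∈S
  ... | no _     | yes refl = y∈S
  ... | no x≢l   | no y≢l with shortest-path (proj₂ (connected x y))
  ... | _ , p , shortest =
    contradiction
      (inner-vertex⇒HasTwoNeighbours p (proj₁ shortest) (proj₁ (UsesEdge⇒∈ p (monitors p shortest)))
         (x≢l ∘ sym) (y≢l ∘ sym))
      (leaf⇒¬HasTwoNeighbours (∈-leaves⁻ l∈))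

  module _ (acyclic : ¬ HasCycle G) where

    path-between-neighbours-length≡1 : ∀ {x y k} → Adj x y → (p : Walk G x y k) → IsPath G p → k ≡ 1
    path-between-neighbours-length≡1 xx []          _  = contradiction xx irrefl
    path-between-neighbours-length≡1 _  (_ ∷ [])    _  = refl
    path-between-neighbours-length≡1 xy (a ∷ b ∷ p) up =
      contradiction (_ , _ , _ , adj-sym xy , a ∷ b ∷ p , s≤s (s≤s z≤n) , up) acyclic

    walk-between-neighbours-uses-edge : ∀ {u v k} → Adj u v → (w : Walk G u v k) → UsesEdge G u v w
    walk-between-neighbours-uses-edge uv w with walk⇒path w
    ... | _ , _ , p , up , p⊆w = p⊆w (path-uses-edge p up)
      where
      path-uses-edge : ∀ {k} (p : Walk G _ _ k) → IsPath G p → UsesEdge G _ _ p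
      path-uses-edge (a ∷ [])      _  = here a [] (inj₁ (refl , refl))
      path-uses-edge []            up with () ← path-between-neighbours-length≡1 uv [] up
      path-uses-edge p@(_ ∷ _ ∷ _) up with () ← path-between-neighbours-length≡1 uv p up

    neighbours-on-path⇒leaf : ∀ {b t k} (p : Walk G b t (suc k)) → IsPath G p →
                              (∀ {d} → Adj b d → d ∈ vertices G p) → IsLeaf G b
    neighbours-on-path⇒leaf {b} (_∷_ {y = c} a p) (b∉ ∷ up) on-path = unique-neighbour⇒leaf a is-c
      where
      is-c : ∀ {d} → Adj b d → d ≡ c
      is-c bd with on-path bd
      ... | here refl = contradiction bd irrefl
      ... | there d∈ with prefix p up d∈
      ...   | _ , q , uq , q⊆p
              with path-between-neighbours-length≡1 bd (a ∷ q) (All.tabulate (All.lookup b∉ ∘ q⊆p) ∷ uq)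
      ...     | refl with q
      ...       | [] = refl

    module _ {u v} (uv : Adj u v) where

      LeafBehind : Set
      LeafBehind = ∃ λ X → IsLeaf G X × ∃ λ k → Σ (Walk G X u k) λ r → v ∉ vertices G r

      unvisited : List (Fin n) → ℕ
      unvisited vs = length (filter (λ z → ¬? (z ∈? vs)) (allFin n))

      unvisited-∷ : ∀ {c vs} → c ∉ vs → unvisited (c ∷ vs) < unvisited vs
      unvisited-∷ {c} {vs} c∉ =
        length-filter-strict-mono (λ z → ¬? (z ∈? vs)) (λ z → ¬? (z ∈? c ∷ vs)) (λ z∉ z∈ → z∉ (there z∈))
          c∉ (λ c∉′ → c∉′ (here refl)) (∈-allFin c)

      -- v counts as visited, so the walk never crosses back over u v.
      grow : ∀ {b k} (r : Walk G b u k) → IsPath G r → v ∉ vertices G r →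
             Acc _<_ (unvisited (vertices G r)) → LeafBehind
      grow {b} r ur v∉ (acc rs) with any? (λ c → adj? b c ×-dec ¬? (c ∈? vertices G (r ▷ uv)))
      ... | yes (c , bc , c∉) =
        let c∉r , c≢v = ∉-▷⁻ r uv c∉
        in grow (adj-sym bc ∷ r) (¬Any⇒All¬ _ c∉r ∷ ur) (λ { (here refl) → c≢v refl ; (there v∈) → v∉ v∈ })
             (rs (unvisited-∷ c∉r))
      ... | no ∄ = b , neighbours-on-path⇒leaf (r ▷ uv) (▷-IsPath r uv ur v∉) on-path , _ , r , v∉
        where
        on-path : ∀ {d} → Adj b d → d ∈ vertices G (r ▷ uv)
        on-path {d} bd with d ∈? vertices G (r ▷ uv)
        ... | yes d∈ = d∈
        ... | no d∉  = contradiction (d , bd , d∉) ∄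

      leaf-behind : LeafBehind
      leaf-behind = grow [] ([] ∷ []) (λ { (here refl) → irrefl uv }) (<-wellFounded _)

    crossing-walk-uses-edge : ∀ {u v X Y k l m} → Adj u v →
                              (rX : Walk G X u k) → v ∉ vertices G rX →
                              (rY : Walk G Y v l) → u ∉ vertices G rY →
                              (w : Walk G X Y m) → UsesEdge G u v w
    crossing-walk-uses-edge uv rX v∉ rY u∉ w with reverse rX
    ... | _ , r , r⊆rX with UsesEdge-++⁻ r _ (walk-between-neighbours-uses-edge uv (r ++ʷ (w ++ʷ rY)))
    ... | inj₁ usesᵣ = contradiction (proj₂ (UsesEdge⇒∈ rX (r⊆rX usesᵣ))) v∉
    ... | inj₂ uses with UsesEdge-++⁻ w rY uses
    ...   | inj₁ usesʷ = usesʷ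
    ...   | inj₂ usesᵧ = contradiction (proj₁ (UsesEdge⇒∈ rY usesᵧ)) u∉

    leaves-IsMEG : IsMEG G (leaves G)
    leaves-IsMEG u v uv with leaf-behind uv | leaf-behind (adj-sym uv)
    ... | X , leafX , _ , rX , v∉ | Y , leafY , _ , rY , u∉ =
      X , Y , ∈-leaves⁺ leafX , ∈-leaves⁺ leafY , λ w _ → crossing-walk-uses-edge uv rX v∉ rY u∉ w

theorem1 : ∀ {n : ℕ} (T : Graph n) → IsTree T → HasEdge T →
    IsMEG T (leaves T)
      × (∀ (S : Subset n) → IsMEG T S → ∣ leaves T ∣ ≤ ∣ S ∣)
      × (∀ (S : Subset n) → IsMEG T S → ∣ S ∣ ≡ ∣ leaves T ∣ → S ≡ leaves T)
theorem1 T (connected , acyclic) _ =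
  leaves-IsMEG T acyclic ,
  (λ S meg → p⊆q⇒∣p∣≤∣q∣ (leaves⊆MEG T connected meg)) ,
  (λ S meg ∣S∣≡ → p⊆q⇒∣q∣≤∣p∣⇒q≡p (leaves⊆MEG T connected meg) (≤-reflexive ∣S∣≡))
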